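{- Let $\mathcal{P}_1,\dots,\mathcal{P}_k$ be one-dimensional patterns with weights, let $Z_1(x),\dots,Z_k(x)\in\mathbb{Z}[x]$, and let $\mathbf{w}:\mathbb{Z}\to\mathbb{C}$ be a word over a finite subset of $\mathbb{C}$. Suppose that $\sum_{(u,g_u)\in F} g_u\,\mathbf{w}(u)=0$ for each $i\in\{1,\dots,k\}$ and each $F\in\mathcal{P}_i$. Let $P(x)=\sum_{i=1}^k Z_i(x)\,\mathrm{Poly}_{\mathcal{P}_i}(x)=\sum_{j=0}^m g_j x^j$. Then \[\sum_{j=0}^m g_j\,\mathbf{w}(j)=0.\]
   Context: A figure with weights in $\mathbb{Z}$ is a finite set $\{(u,g_u): u\in F, g_u\in\mathbb{Z}\}$ with $F\subset\mathbb{Z}$ finite. A pattern with weights is the set of all integer translates (points shifted, weights kept) of a fixed figure with weights. The canonical figure $F_{\mathcal{P}}$ of $\mathcal{P}$ is the member of $\mathcal{P}$ whose points are all nonnegative with minimal point $0$, and $\mathrm{Poly}_{\mathcal{P}}(x)=\sum_{(t,g_t)\in F_{\mathcal{P}}} g_t x^t$. -}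

module Defs where

open import Level using (Level)
open import Data.Nat using (ℕ; zero; suc)
open import Data.Integer as ℤ using (ℤ; +_; -[1+_]; _⊓_; ∣_∣)
open import Data.Product using (_×_; _,_; proj₁; proj₂)
open import Data.List using (List; []; _∷_; map; replicate; _++_; foldr)
open import Data.List.NonEmpty using (List⁺; _∷_; toList)
open import Data.Fin using (Fin; zero; suc)
open import Algebra.Bundles using (CommutativeRing)

-- A one-dimensional figure with weights: a finite list of (point , weight) pairs.
-- It is nonempty (so that the canonical figure / minimal point exists).
Figure : Set
Figure = List⁺ (ℤ × ℤ)

points : Figure → List ℤ
points F = map proj₁ (toList F)

translate : ℤ → Figure → Figure
translate t ((u , g) ∷ rest) = (u ℤ.+ t , g) ∷ map (λ p → (proj₁ p ℤ.+ t , proj₂ p)) rest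

-- the pattern generated by F is { translate t F : t ∈ ℤ };
-- minimal point of a figure
minPoint : Figure → ℤ
minPoint ((u , _) ∷ rest) = foldr (λ p m → proj₁ p ⊓ m) u rest

canonical : Figure → Figure
canonical F = translate (ℤ.- minPoint F) F

-- Integer polynomials as dense coefficient lists (coefficient of x^0 first).
Poly : Set
Poly = List ℤ

infixl 6 _+P_
infixl 7 _*P_

_+P_ : Poly → Poly → Poly
[] +P q = q
(a ∷ p) +P [] = a ∷ p
(a ∷ p) +P (b ∷ q) = (a ℤ.+ b) ∷ (p +P q)

_*P_ : Poly → Poly → Poly
[] *P q = []
(a ∷ p) *P q = map (a ℤ.*_) q +P ((+ 0) ∷ (p *P q))

monomial : ℕ → ℤ → Poly
monomial n g = replicate n (+ 0) ++ (g ∷ [])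

-- Poly_P(x) = Σ_{(t,g_t) ∈ F_P} g_t x^t, for the pattern P generated by F
-- (points of the canonical figure are nonnegative, so t = + ∣ t ∣).
polyPattern : Figure → Poly
polyPattern F = foldr (λ p acc → monomial ∣ proj₁ p ∣ (proj₂ p) +P acc) [] (toList (canonical F))

sumP : (k : ℕ) → (Fin k → Poly) → Poly
sumP zero f = []
sumP (suc k) f = f zero +P sumP k (λ i → f (suc i))

module Eval {c ℓ : Level} (R : CommutativeRing c ℓ) where
  open CommutativeRing R

  natMul : ℕ → Carrier → Carrier
  natMul zero x = 0#
  natMul (suc n) x = x + natMul n x

  intMul : ℤ → Carrier → Carrier
  intMul (+ n) x = natMul n x
  intMul -[1+ n ] x = - natMul (suc n) x

  figureSum : (ℤ → Carrier) → Figure → Carrier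
  figureSum w F = foldr (λ p acc → intMul (proj₂ p) (w (proj₁ p)) + acc) 0# (toList F)

  pairFrom : (ℤ → Carrier) → ℕ → Poly → Carrier
  pairFrom w k [] = 0#
  pairFrom w k (g ∷ p) = intMul g (w (+ k)) + pairFrom w (suc k) p

  polySum : (ℤ → Carrier) → Poly → Carrier
  polySum w p = pairFrom w 0 p

-- Pair a polynomial q with the word w at offset j: ⟨q⟩ⱼ = Σᵢ qᵢ w(i + j), which is
-- pairFrom w j q.  This is ℤ-linear in q, and multiplying q by x turns offset j into
-- offset j + 1, so the polynomials with ⟨q⟩ⱼ = 0 for every j form an ideal of ℤ[x].
-- Each Poly_𝒫 lies in this ideal, since ⟨Poly_𝒫⟩ⱼ is the weighted sum of w over a
-- translate of the canonical figure.  Hence so does P, and ⟨P⟩₀ is the sum in question.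
module Submission where

open import Defs
open import Level using (Level)
open import Data.Nat using (ℕ)
open import Data.Integer using (ℤ)
open import Data.Fin using (Fin)
open import Data.Product using (Σ)
open import Data.List using (List)
open import Data.List.Relation.Unary.Any using (Any)
open import Data.List.Relation.Unary.Unique.Propositional using (Unique)
open import Algebra.Bundles using (CommutativeRing)

import Data.Nat as ℕ
import Data.Nat.Properties as ℕₚ
import Data.Integer as ℤ
import Data.Integer.Properties as ℤₚ
open import Data.Product using (_,_; proj₁; proj₂)
open import Data.List using ([]; _∷_; map; foldr)
open import Data.List.NonEmpty using (_∷_; toList)
open import Data.List.Relation.Unary.All as All using (All; []; _∷_)
open import Data.Fin using (zero; suc)
open import Relation.Binary.PropositionalEquality as ≡ using (_≡_)

module IntegerMultiples {c ℓ : Level} (R : CommutativeRing c ℓ) where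
  open CommutativeRing R
  open Eval R using (natMul; intMul)
  open import Algebra.Properties.CommutativeMonoid.Mult +-commutativeMonoid
    using (_×_; ×-congʳ; ×-homo-+; ×-distrib-+)
  open import Algebra.Properties.CommutativeSemigroup +-commutativeSemigroup
    using (interchange)
  open import Algebra.Properties.Ring ring using (-‿+-comm; -0#≈0#; -‿involutive)
  open import Relation.Binary.Reasoning.Setoid setoid

  natMul≡× : ∀ n x → natMul n x ≡ n × x
  natMul≡× ℕ.zero    x = ≡.refl
  natMul≡× (ℕ.suc n) x = ≡.cong (x +_) (natMul≡× n x)

  ×-zeroʳ : ∀ n → n × 0# ≈ 0#
  ×-zeroʳ ℕ.zero    = refl
  ×-zeroʳ (ℕ.suc n) = trans (+-identityˡ _) (×-zeroʳ n)

  intMul-congʳ : ∀ a {x y} → x ≈ y → intMul a x ≈ intMul a y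
  intMul-congʳ (ℤ.+ n) {x} {y} x≈y
    rewrite natMul≡× n x | natMul≡× n y = ×-congʳ n x≈y
  intMul-congʳ ℤ.-[1+ n ] {x} {y} x≈y
    rewrite natMul≡× n x | natMul≡× n y = -‿cong (×-congʳ (ℕ.suc n) x≈y)

  intMul-zeroʳ : ∀ a → intMul a 0# ≈ 0#
  intMul-zeroʳ (ℤ.+ n) rewrite natMul≡× n 0# = ×-zeroʳ n
  intMul-zeroʳ ℤ.-[1+ n ] rewrite natMul≡× n 0# = trans (-‿cong (×-zeroʳ (ℕ.suc n))) -0#≈0#

  intMul-distribˡ-+ : ∀ a x y → intMul a (x + y) ≈ intMul a x + intMul a y
  intMul-distribˡ-+ (ℤ.+ n) x y
    rewrite natMul≡× n (x + y) | natMul≡× n x | natMul≡× n y = ×-distrib-+ x y n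
  intMul-distribˡ-+ ℤ.-[1+ n ] x y
    rewrite natMul≡× n (x + y) | natMul≡× n x | natMul≡× n y =
      trans (-‿cong (×-distrib-+ x y (ℕ.suc n))) (sym (-‿+-comm _ _))

  intMul-⊖ : ∀ m n x → intMul (m ℤ.⊖ n) x ≈ m × x - n × x
  intMul-⊖ m ℕ.zero x rewrite natMul≡× m x =
    sym (trans (+-congˡ -0#≈0#) (+-identityʳ _))
  intMul-⊖ ℕ.zero (ℕ.suc n) x rewrite natMul≡× n x = sym (+-identityˡ _)
  intMul-⊖ (ℕ.suc m) (ℕ.suc n) x = begin
    intMul (ℕ.suc m ℤ.⊖ ℕ.suc n) x   ≡⟨ ≡.cong (λ a → intMul a x) (ℤₚ.[1+m]⊖[1+n]≡m⊖n m n) ⟩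
    intMul (m ℤ.⊖ n) x               ≈⟨ intMul-⊖ m n x ⟩
    m × x - n × x                    ≈⟨ +-identityˡ _ ⟨
    0# + (m × x - n × x)             ≈⟨ +-congʳ (-‿inverseʳ x) ⟨
    (x - x) + (m × x - n × x)        ≈⟨ interchange x (- x) (m × x) (- (n × x)) ⟩
    (x + m × x) + (- x - n × x)      ≈⟨ +-congˡ (-‿+-comm x (n × x)) ⟩
    ℕ.suc m × x - ℕ.suc n × x        ∎

  intMul-homo-+ : ∀ a b x → intMul (a ℤ.+ b) x ≈ intMul a x + intMul b x
  intMul-homo-+ (ℤ.+ m) (ℤ.+ n) x
    rewrite natMul≡× (m ℕ.+ n) x | natMul≡× m x | natMul≡× n x = ×-homo-+ x m n
  intMul-homo-+ (ℤ.+ m) ℤ.-[1+ n ] x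
    rewrite natMul≡× m x | natMul≡× n x = intMul-⊖ m (ℕ.suc n) x
  intMul-homo-+ ℤ.-[1+ m ] (ℤ.+ n) x
    rewrite natMul≡× m x | natMul≡× n x = trans (intMul-⊖ n (ℕ.suc m) x) (+-comm _ _)
  intMul-homo-+ ℤ.-[1+ m ] ℤ.-[1+ n ] x
    rewrite natMul≡× (ℕ.suc (m ℕ.+ n)) x | natMul≡× m x | natMul≡× n x = begin
      - (ℕ.suc (ℕ.suc (m ℕ.+ n)) × x)      ≡⟨ ≡.cong (λ k → - (ℕ.suc k × x)) (ℕₚ.+-suc m n) ⟨
      - ((ℕ.suc m ℕ.+ ℕ.suc n) × x)         ≈⟨ -‿cong (×-homo-+ x (ℕ.suc m) (ℕ.suc n)) ⟩
      - (ℕ.suc m × x + ℕ.suc n × x)         ≈⟨ -‿+-comm _ _ ⟨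
      - (ℕ.suc m × x) - ℕ.suc n × x         ∎

  intMul-neg : ∀ a x → intMul (ℤ.- a) x ≈ - intMul a x
  intMul-neg (ℤ.+ ℕ.zero)    x = sym -0#≈0#
  intMul-neg (ℤ.+ ℕ.suc n)   x = refl
  intMul-neg ℤ.-[1+ n ]      x = sym (-‿involutive _)

  intMul-+* : ∀ m b x → intMul (ℤ.+ m ℤ.* b) x ≈ m × intMul b x
  intMul-+* ℕ.zero    b x = refl
  intMul-+* (ℕ.suc m) b x = begin
    intMul (ℤ.+ ℕ.suc m ℤ.* b) x             ≡⟨ ≡.cong (λ a → intMul a x) (ℤₚ.suc-* (ℤ.+ m) b) ⟩
    intMul (b ℤ.+ ℤ.+ m ℤ.* b) x             ≈⟨ intMul-homo-+ b (ℤ.+ m ℤ.* b) x ⟩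
    intMul b x + intMul (ℤ.+ m ℤ.* b) x      ≈⟨ +-congˡ (intMul-+* m b x) ⟩
    ℕ.suc m × intMul b x                     ∎

  intMul-homo-* : ∀ a b x → intMul (a ℤ.* b) x ≈ intMul a (intMul b x)
  intMul-homo-* (ℤ.+ m) b x rewrite natMul≡× m (intMul b x) = intMul-+* m b x
  intMul-homo-* ℤ.-[1+ m ] b x rewrite natMul≡× m (intMul b x) = begin
    intMul (ℤ.-[1+ m ] ℤ.* b) x              ≡⟨ ≡.cong (λ a → intMul a x) (ℤₚ.neg-distribˡ-* (ℤ.+ ℕ.suc m) b) ⟨
    intMul (ℤ.- (ℤ.+ ℕ.suc m ℤ.* b)) x      ≈⟨ intMul-neg (ℤ.+ ℕ.suc m ℤ.* b) x ⟩
    - intMul (ℤ.+ ℕ.suc m ℤ.* b) x          ≈⟨ -‿cong (intMul-+* (ℕ.suc m) b x) ⟩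
    - (ℕ.suc m × intMul b x)                 ∎

module Figures where
  open import Data.Product using (_×_)
  open import Data.List.Properties using (map-∘; map-cong)
  open import Data.List.Relation.Unary.All.Properties using (map⁺)

  shift : ℤ → ℤ × ℤ → ℤ × ℤ
  shift t p = (proj₁ p ℤ.+ t , proj₂ p)

  map-shift-shift : ∀ a b L → map (shift a) (map (shift b) L) ≡ map (shift (b ℤ.+ a)) L
  map-shift-shift a b L = ≡.trans (≡.sym (map-∘ L))
    (map-cong (λ p → ≡.cong (_, proj₂ p) (ℤₚ.+-assoc (proj₁ p) b a)) L)

  minFrom : ℤ → List (ℤ × ℤ) → ℤ
  minFrom u = foldr (λ p m → proj₁ p ℤ.⊓ m) u

  minFrom-≤-init : ∀ u L → minFrom u L ℤ.≤ u
  minFrom-≤-init u []      = ℤₚ.≤-refl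
  minFrom-≤-init u (p ∷ L) = ℤₚ.≤-trans (ℤₚ.i⊓j≤j _ _) (minFrom-≤-init u L)

  minFrom-≤-all : ∀ u L → All (λ p → minFrom u L ℤ.≤ proj₁ p) L
  minFrom-≤-all u []      = []
  minFrom-≤-all u (p ∷ L) =
    ℤₚ.i⊓j≤i _ _ ∷ All.map (ℤₚ.≤-trans (ℤₚ.i⊓j≤j _ _)) (minFrom-≤-all u L)

  minPoint-≤-all : ∀ F → All (λ p → minPoint F ℤ.≤ proj₁ p) (toList F)
  minPoint-≤-all ((u , _) ∷ rest) = minFrom-≤-init u rest ∷ minFrom-≤-all u rest

  canonical-nonneg : ∀ F → All (λ p → ℤ.+ 0 ℤ.≤ proj₁ p) (toList (canonical F))
  canonical-nonneg F@(_ ∷ _) =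
    map⁺ {f = shift (ℤ.- minPoint F)} (All.map ℤₚ.i≤j⇒0≤j-i (minPoint-≤-all F))

module Pairing {c ℓ : Level} (R : CommutativeRing c ℓ) (w : ℤ → CommutativeRing.Carrier R) where
  open CommutativeRing R hiding (zero)
  open Eval R using (intMul; pairFrom; figureSum)
  open IntegerMultiples R
  open Figures
  open import Data.Product using (_×_)
  open import Algebra.Properties.CommutativeSemigroup +-commutativeSemigroup
    using (interchange)
  open import Relation.Binary.Reasoning.Setoid setoid

  pairFrom-+P : ∀ k p q → pairFrom w k (p +P q) ≈ pairFrom w k p + pairFrom w k q
  pairFrom-+P k []      q       = sym (+-identityˡ _)
  pairFrom-+P k (a ∷ p) []      = sym (+-identityʳ _)
  pairFrom-+P k (a ∷ p) (b ∷ q) = begin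
    intMul (a ℤ.+ b) (w (ℤ.+ k)) + pairFrom w (ℕ.suc k) (p +P q)
      ≈⟨ +-cong (intMul-homo-+ a b _) (pairFrom-+P (ℕ.suc k) p q) ⟩
    (intMul a (w (ℤ.+ k)) + intMul b (w (ℤ.+ k))) + (pairFrom w (ℕ.suc k) p + pairFrom w (ℕ.suc k) q)
      ≈⟨ interchange _ _ _ _ ⟩
    (intMul a (w (ℤ.+ k)) + pairFrom w (ℕ.suc k) p) + (intMul b (w (ℤ.+ k)) + pairFrom w (ℕ.suc k) q)
      ∎

  pairFrom-scale : ∀ k a q → pairFrom w k (map (a ℤ.*_) q) ≈ intMul a (pairFrom w k q)
  pairFrom-scale k a []      = sym (intMul-zeroʳ a)
  pairFrom-scale k a (g ∷ q) = begin
    intMul (a ℤ.* g) (w (ℤ.+ k)) + pairFrom w (ℕ.suc k) (map (a ℤ.*_) q)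
      ≈⟨ +-cong (intMul-homo-* a g _) (pairFrom-scale (ℕ.suc k) a q) ⟩
    intMul a (intMul g (w (ℤ.+ k))) + intMul a (pairFrom w (ℕ.suc k) q)
      ≈⟨ intMul-distribˡ-+ a _ _ ⟨
    intMul a (intMul g (w (ℤ.+ k)) + pairFrom w (ℕ.suc k) q)
      ∎

  pairFrom-monomial : ∀ n k g → pairFrom w k (monomial n g) ≈ intMul g (w (ℤ.+ (n ℕ.+ k)))
  pairFrom-monomial ℕ.zero    k g = +-identityʳ _
  pairFrom-monomial (ℕ.suc n) k g = begin
    0# + pairFrom w (ℕ.suc k) (monomial n g)  ≈⟨ +-identityˡ _ ⟩
    pairFrom w (ℕ.suc k) (monomial n g)       ≈⟨ pairFrom-monomial n (ℕ.suc k) g ⟩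
    intMul g (w (ℤ.+ (n ℕ.+ ℕ.suc k)))        ≡⟨ ≡.cong (λ i → intMul g (w (ℤ.+ i))) (ℕₚ.+-suc n k) ⟩
    intMul g (w (ℤ.+ ℕ.suc (n ℕ.+ k)))        ∎

  weightedSum : List (ℤ × ℤ) → Carrier
  weightedSum = foldr (λ p acc → intMul (proj₂ p) (w (proj₁ p)) + acc) 0#

  listPoly : List (ℤ × ℤ) → Poly
  listPoly = foldr (λ p acc → monomial ℤ.∣ proj₁ p ∣ (proj₂ p) +P acc) []

  pairFrom-listPoly : ∀ k L → All (λ p → ℤ.+ 0 ℤ.≤ proj₁ p) L →
                      pairFrom w k (listPoly L) ≈ weightedSum (map (shift (ℤ.+ k)) L)
  pairFrom-listPoly k []             []           = refl
  pairFrom-listPoly k ((u , g) ∷ L) (0≤u ∷ 0≤L) = begin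
    pairFrom w k (monomial ℤ.∣ u ∣ g +P listPoly L)
      ≈⟨ pairFrom-+P k (monomial ℤ.∣ u ∣ g) (listPoly L) ⟩
    pairFrom w k (monomial ℤ.∣ u ∣ g) + pairFrom w k (listPoly L)
      ≈⟨ +-cong (pairFrom-monomial ℤ.∣ u ∣ k g) (pairFrom-listPoly k L 0≤L) ⟩
    intMul g (w (ℤ.+ ℤ.∣ u ∣ ℤ.+ ℤ.+ k)) + weightedSum (map (shift (ℤ.+ k)) L)
      ≡⟨ ≡.cong (λ v → intMul g (w (v ℤ.+ ℤ.+ k)) + _) (ℤₚ.0≤i⇒+∣i∣≡i 0≤u) ⟩
    intMul g (w (u ℤ.+ ℤ.+ k)) + weightedSum (map (shift (ℤ.+ k)) L)
      ∎

  Annihilates : Poly → Set ℓ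
  Annihilates q = ∀ j → pairFrom w j q ≈ 0#

  annihilates-+P : ∀ {p q} → Annihilates p → Annihilates q → Annihilates (p +P q)
  annihilates-+P {p} {q} ann-p ann-q j = begin
    pairFrom w j (p +P q)            ≈⟨ pairFrom-+P j p q ⟩
    pairFrom w j p + pairFrom w j q  ≈⟨ +-cong (ann-p j) (ann-q j) ⟩
    0# + 0#                          ≈⟨ +-identityˡ 0# ⟩
    0#                               ∎

  annihilates-*P : ∀ p {q} → Annihilates q → Annihilates (p *P q)
  annihilates-*P []      ann-q j = refl
  annihilates-*P (a ∷ p) {q} ann-q =
    annihilates-+P {map (a ℤ.*_) q} {ℤ.+ 0 ∷ (p *P q)} ann-aq ann-xpq
    where
    ann-aq : Annihilates (map (a ℤ.*_) q)
    ann-aq j = trans (pairFrom-scale j a q) (trans (intMul-congʳ a (ann-q j)) (intMul-zeroʳ a))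

    ann-xpq : Annihilates (ℤ.+ 0 ∷ (p *P q))
    ann-xpq j = trans (+-identityˡ _) (annihilates-*P p ann-q (ℕ.suc j))

  annihilates-sumP : ∀ k {f : Fin k → Poly} → (∀ i → Annihilates (f i)) → Annihilates (sumP k f)
  annihilates-sumP ℕ.zero    ann-f j = refl
  annihilates-sumP (ℕ.suc k) {f} ann-f =
    annihilates-+P {f zero} {sumP k (λ i → f (suc i))}
      (ann-f zero) (annihilates-sumP k (λ i → ann-f (suc i)))

  annihilates-polyPattern : ∀ F → (∀ t → figureSum w (translate t F) ≈ 0#) →
                            Annihilates (polyPattern F)
  annihilates-polyPattern F@(_ ∷ _) vanishes j = begin
    pairFrom w j (listPoly (toList (canonical F)))
      ≈⟨ pairFrom-listPoly j _ (canonical-nonneg F) ⟩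
    weightedSum (map (shift (ℤ.+ j)) (map (shift m) (toList F)))
      ≡⟨ ≡.cong weightedSum (map-shift-shift (ℤ.+ j) m (toList F)) ⟩
    figureSum w (translate (m ℤ.+ ℤ.+ j) F)
      ≈⟨ vanishes (m ℤ.+ ℤ.+ j) ⟩
    0#
      ∎
    where m = ℤ.- minPoint F

open CommutativeRing using (Carrier; _≈_; 0#)
open Eval using (figureSum; polySum)

lemma1 : {c ℓ : Level} (R : CommutativeRing c ℓ) →
    (k : ℕ) (𝒫 : Fin k → Figure) → (∀ i → Unique (points (𝒫 i))) →
    (Z : Fin k → Poly) (w : ℤ → Carrier R) →
    Σ (List (Carrier R)) (λ S → ∀ u → Any (λ s → _≈_ R (w u) s) S) →
    (∀ i (t : ℤ) → _≈_ R (figureSum R w (translate t (𝒫 i))) (0# R)) →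
    _≈_ R (polySum R w (sumP k (λ i → Z i *P polyPattern (𝒫 i)))) (0# R)
lemma1 R k 𝒫 _ Z w _ vanishes =
  annihilates-sumP k (λ i → annihilates-*P (Z i) (annihilates-polyPattern (𝒫 i) (vanishes i))) 0
  where open Pairing R w
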